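{- Let $e$ and $d$ be degree sequences such that $e\preccurlyeq d$ in the Rao order. Then $\Delta^*(e)\le\Delta^*(d)$.
   Context: Degree sequences are written in nonincreasing order. For degree sequences $e,d$, $e\preccurlyeq d$ (Rao order) means there exist a simple graph $H$ with degree sequence $e$ and a simple graph $G$ with degree sequence $d$ such that $H$ is an induced subgraph of $G$. $m(d)=\max\{i:d_i\ge i-1\}$, $\Delta_k(d)=k(k-1)+\sum_{i>k}\min\{k,d_i\}-\sum_{i\le k}d_i$, and $\Delta^*(d)=\max\{\Delta_k(d):1\le k\le m(d)\}$. -}

module Defs where

open import Data.Nat using (ℕ; zero; suc; _≤_; _⊔_; _⊓_; _≤ᵇ_)
open import Data.Fin using (Fin; toℕ)
open import Data.Bool using (Bool; true; false; if_then_else_)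
open import Data.List using (List; map; foldr; allFin; upTo)
open import Data.Nat.ListAction using (sum)
open import Data.Product using (Σ; ∃; _×_; _,_)
open import Relation.Binary.PropositionalEquality using (_≡_)
open import Function.Definitions using (Injective)
open import Data.Integer as ℤ using (ℤ; +_)

record SimpleGraph (n : ℕ) : Set where
  field
    adj    : Fin n → Fin n → Bool
    sym    : ∀ i j → adj i j ≡ adj j i
    irrefl : ∀ i → adj i i ≡ false
open SimpleGraph public

degree : ∀ {n} → SimpleGraph n → Fin n → ℕ
degree {n} G i = sum (map (λ j → if adj G i j then 1 else 0) (allFin n))

-- A sequence of length n, 0-indexed: d (i) is the paper's d_{i+1}.
Seq : ℕ → Set
Seq n = Fin n → ℕ

Nonincreasing : ∀ {n} → Seq n → Set
Nonincreasing {n} d = ∀ (i j : Fin n) → toℕ i ≤ toℕ j → d j ≤ d i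

HasDegSeq : ∀ {n} → SimpleGraph n → Seq n → Set
HasDegSeq {n} G d = ∀ (i : Fin n) → degree G i ≡ d i

IsDegSeq : ∀ {n} → Seq n → Set
IsDegSeq {n} d = Nonincreasing d × Σ (SimpleGraph n) (λ G → HasDegSeq G d)

InducedSubgraph : ∀ {m n} → SimpleGraph m → SimpleGraph n → Set
InducedSubgraph {m} {n} H G =
  Σ (Fin m → Fin n) (λ f → Injective _≡_ _≡_ f × (∀ i j → adj H i j ≡ adj G (f i) (f j)))

_≼_ : ∀ {m n} → Seq m → Seq n → Set
_≼_ {m} {n} e d =
  Σ (SimpleGraph m) (λ H → Σ (SimpleGraph n) (λ G →
    HasDegSeq H e × HasDegSeq G d × InducedSubgraph H G))

-- m(d) = max { i (1-indexed) : d_i ≥ i - 1 }  (0 if the set is empty)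
mOf : ∀ {n} → Seq n → ℕ
mOf {n} d = foldr _⊔_ 0
  (map (λ i → if toℕ i ≤ᵇ d i then suc (toℕ i) else 0) (allFin n))

-- Δ_k(d) = k(k-1) + Σ_{i>k} min{k, d_i} - Σ_{i≤k} d_i   (in ℤ; 1-indexed i)
Δ : ∀ {n} → ℕ → Seq n → ℤ
Δ {n} k d =
  (+ (k Data.Nat.* (k Data.Nat.∸ 1)))
  ℤ.+ (+ sum (map (λ i → if k ≤ᵇ toℕ i then k ⊓ d i else 0) (allFin n)))
  ℤ.- (+ sum (map (λ i → if k ≤ᵇ toℕ i then 0 else d i) (allFin n)))

-- Δ*(d) = max { Δ_k(d) : 1 ≤ k ≤ m(d) }.  For nonempty d we have m(d) ≥ 1,
-- so seeding the fold with Δ_1(d) does not change the maximum.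
Δ* : ∀ {n} → Seq (suc n) → ℤ
Δ* d = foldr ℤ._⊔_ (Δ 1 d) (map (λ k → Δ (suc k) d) (upTo (mOf d)))

-- Let H be an induced subgraph of G, with degree sequences e and d, and let P be the
-- first j vertices of G, containing c vertices S of H.  Counting the ordered adjacent
-- pairs at P in G and at S in H (as in the Erdős–Gallai theorem) gives
--   c(c-1) + Σ_{x ∈ H∖P} min(c, deg_H x) - Σ_{x ∈ S} deg_H x  ≤  Δ_j(d),
-- and the left side is at least Δ_c(e), since the c largest terms of e minimise it.
-- As j grows, c grows in steps of at most one, so each k ≤ m(e) occurs as c for some
-- j ≤ m(d), unless c < k already at j = m(d).  In that case the clamps min(j, ·) in
-- Δ_j(d) are inactive, and comparing the same count without clamps with e_u ≥ k-1 for
-- the first k terms of e gives Δ_k(e) ≤ Δ_{m(d)}(d).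
module Submission where

open import Defs hiding (sym)
open import Data.Bool using (Bool; true; false; if_then_else_; T)
open import Data.Fin using (Fin; zero; suc; toℕ; fromℕ<)
import Data.Fin.Properties as Fin
open import Relation.Nullary using (does; yes; no)
open import Data.Nat
open import Data.Nat.Properties
open import Data.Nat.Tactic.RingSolver using (solve-∀)
open import Data.Product using (_×_; _,_; Σ-syntax)
open import Data.List using (map; allFin; tabulate)
import Data.Nat.ListAction as List
import Data.Integer as ℤ
import Data.Integer.Properties as ℤ
open import Function using (_∘_)
open import Function.Definitions using (Injective)
open import Data.Empty using (⊥-elim)
open import Data.Sum using (_⊎_; inj₁; inj₂)
open import Data.List.Properties using (map-tabulate; foldr-preservesᵒ; foldr-preservesᵇ)
import Data.List.Relation.Unary.All.Properties as All
import Data.List.Relation.Unary.Any.Properties as Any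
open import Relation.Binary.PropositionalEquality
open import Algebra.Properties.Semiring.Sum +-*-semiring
  using (sum; sum-syntax; ∑-distrib-+; ∑-comm; *-distribˡ-sum; *-distribʳ-sum; sum-cong-≗;
         sum-replicate-zero)
open import Algebra.Properties.CommutativeSemigroup +-commutativeSemigroup
  using () renaming (x∙yz≈y∙xz to x+[y+z]≡y+[x+z])
open import Algebra.Properties.CommutativeSemigroup *-commutativeSemigroup
  using () renaming (x∙yz≈y∙xz to x*[y*z]≡y*[x*z])

∑-mono-≤ : ∀ {n} {f g : Fin n → ℕ} → (∀ i → f i ≤ g i) → sum f ≤ sum g
∑-mono-≤ {zero}  _   = z≤n
∑-mono-≤ {suc n} f≤g = +-mono-≤ (f≤g zero) (∑-mono-≤ (f≤g ∘ suc))

sum-tabulate : ∀ n (f : Fin n → ℕ) → List.sum (tabulate f) ≡ sum f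
sum-tabulate zero    f = refl
sum-tabulate (suc n) f = cong (f zero +_) (sum-tabulate n (f ∘ suc))

sum-allFin : ∀ n (f : Fin n → ℕ) → List.sum (map f (allFin n)) ≡ sum f
sum-allFin n f = trans (cong List.sum (map-tabulate (λ i → i) f)) (sum-tabulate n f)

-- A vertex subset is given by the predicate `out` of its complement, matching the
-- tests `k ≤ᵇ toℕ i` in the definition of Δ.
inside outside : ∀ {n} → (Fin n → Bool) → (Fin n → ℕ) → Fin n → ℕ
inside  out g u = if out u then 0 else g u
outside out g u = if out u then g u else 0

∑-in ∑-out : ∀ {n} → (Fin n → Bool) → (Fin n → ℕ) → ℕ
∑-in  out g = sum (inside out g)
∑-out out g = sum (outside out g)

#inside : ∀ {n} → (Fin n → Bool) → ℕ
#inside out = ∑-in out (λ _ → 1)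

∑-out+∑-in : ∀ {n} (out : Fin n → Bool) g → ∑-out out g + ∑-in out g ≡ sum g
∑-out+∑-in out g = trans (sym (∑-distrib-+ (outside out g) (inside out g))) (sum-cong-≗ split)
  where
  split : ∀ u → outside out g u + inside out g u ≡ g u
  split u with out u
  ... | true  = +-identityʳ _
  ... | false = refl

∑-in-+ : ∀ {n} (out : Fin n → Bool) f g → ∑-in out (λ u → f u + g u) ≡ ∑-in out f + ∑-in out g
∑-in-+ out f g = trans (sum-cong-≗ split) (∑-distrib-+ (inside out f) (inside out g))
  where
  split : ∀ u → inside out (λ u → f u + g u) u ≡ inside out f u + inside out g u
  split u with out u
  ... | true  = refl
  ... | false = refl

∑-out-mono : ∀ {n} (out : Fin n → Bool) {g h : Fin n → ℕ} → (∀ u → g u ≤ h u) → ∑-out out g ≤ ∑-out out h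
∑-out-mono out {g} {h} g≤h = ∑-mono-≤ pointwise
  where
  pointwise : ∀ u → outside out g u ≤ outside out h u
  pointwise u with out u
  ... | true  = g≤h u
  ... | false = z≤n

∑-out-+ : ∀ {n} (out : Fin n → Bool) f g → ∑-out out (λ u → f u + g u) ≡ ∑-out out f + ∑-out out g
∑-out-+ out f g = trans (sum-cong-≗ split) (∑-distrib-+ (outside out f) (outside out g))
  where
  split : ∀ u → outside out (λ u → f u + g u) u ≡ outside out f u + outside out g u
  split u with out u
  ... | true  = refl
  ... | false = refl

∑-in-cong : ∀ {n} (out : Fin n → Bool) {g h : Fin n → ℕ} → (∀ u → g u ≡ h u) → ∑-in out g ≡ ∑-in out h
∑-in-cong out g≡h = sum-cong-≗ λ u → cong (λ x → if out u then 0 else x) (g≡h u)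

∑-out-cong : ∀ {n} (out : Fin n → Bool) {g h : Fin n → ℕ} → (∀ u → g u ≡ h u) → ∑-out out g ≡ ∑-out out h
∑-out-cong out g≡h = sum-cong-≗ λ u → cong (λ x → if out u then x else 0) (g≡h u)

-- Sums along a map of finite sets

δ : ∀ {n} → Fin n → Fin n → ℕ
δ v w = if does (v Fin.≟ w) then 1 else 0

∑-δ : ∀ {n} v (φ : Fin n → ℕ) → ∑[ w < n ] (δ v w * φ w) ≡ φ v
∑-δ {suc n} zero    φ = trans (cong (φ zero + 0 +_) (sum-replicate-zero n)) (trans (+-identityʳ _) (+-identityʳ _))
∑-δ {suc n} (suc v) φ = ∑-δ v (φ ∘ suc)

multiplicity : ∀ {m n} → (Fin m → Fin n) → Fin n → ℕ
multiplicity {m} f w = ∑[ u < m ] δ (f u) w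

∑-∘ : ∀ {m n} (f : Fin m → Fin n) (φ : Fin n → ℕ) →
  ∑[ u < m ] φ (f u) ≡ ∑[ w < n ] (multiplicity f w * φ w)
∑-∘ {m} {n} f φ = sym (begin
  ∑[ w < n ] (multiplicity f w * φ w)             ≡⟨ sum-cong-≗ (λ w → *-distribʳ-sum (φ w) (λ u → δ (f u) w)) ⟩
  ∑[ w < n ] ∑[ u < m ] (δ (f u) w * φ w)         ≡⟨ ∑-comm (λ w u → δ (f u) w * φ w) ⟩
  ∑[ u < m ] ∑[ w < n ] (δ (f u) w * φ w)         ≡⟨ sum-cong-≗ (λ u → ∑-δ (f u) φ) ⟩
  ∑[ u < m ] φ (f u)                              ∎)
  where open ≡-Reasoning

∑-in-∘ : ∀ {m n} (f : Fin m → Fin n) out g →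
  ∑-in (out ∘ f) (g ∘ f) ≡ ∑-in out (λ w → multiplicity f w * g w)
∑-in-∘ f out g = trans (∑-∘ f (inside out g)) (sum-cong-≗ pull)
  where
  pull : ∀ w → multiplicity f w * inside out g w ≡ inside out (λ w → multiplicity f w * g w) w
  pull w with out w
  ... | true  = *-zeroʳ (multiplicity f w)
  ... | false = refl

∑-out-∘ : ∀ {m n} (f : Fin m → Fin n) out g →
  ∑-out (out ∘ f) (g ∘ f) ≡ ∑-out out (λ w → multiplicity f w * g w)
∑-out-∘ f out g = trans (∑-∘ f (outside out g)) (sum-cong-≗ pull)
  where
  pull : ∀ w → multiplicity f w * outside out g w ≡ outside out (λ w → multiplicity f w * g w) w
  pull w with out w
  ... | true  = refl
  ... | false = *-zeroʳ (multiplicity f w)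

multiplicity-∉ : ∀ {m n} (f : Fin m → Fin n) w → (∀ u → f u ≢ w) → multiplicity f w ≡ 0
multiplicity-∉ {zero}  f w f≢w = refl
multiplicity-∉ {suc m} f w f≢w with f zero Fin.≟ w
... | yes f0≡w = ⊥-elim (f≢w zero f0≡w)
... | no  _    = multiplicity-∉ (f ∘ suc) w (f≢w ∘ suc)

multiplicity≤1 : ∀ {m n} (f : Fin m → Fin n) → Injective _≡_ _≡_ f → ∀ w → multiplicity f w ≤ 1
multiplicity≤1 {zero}  f f-inj w = z≤n
multiplicity≤1 {suc m} f f-inj w with f zero Fin.≟ w
... | yes refl = ≤-reflexive (cong suc (multiplicity-∉ (f ∘ suc) (f zero) (λ u → Fin.0≢1+n ∘ f-inj ∘ sym)))
... | no  _    = multiplicity≤1 (f ∘ suc) (λ eq → Fin.suc-injective (f-inj eq)) w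

-- Prefix sums of nonincreasing sequences

beyond : ∀ {n} → ℕ → Fin n → Bool
beyond k u = k ≤ᵇ toℕ u

prefix suffix : ∀ {n} → ℕ → (Fin n → ℕ) → ℕ
prefix k = ∑-in (beyond k)
suffix k = ∑-out (beyond k)

beyond-suc : ∀ {n} c (u : Fin n) → beyond (suc c) (suc u) ≡ beyond c u
beyond-suc zero    u = refl
beyond-suc (suc c) u = refl

prefix-zero : ∀ {n} (h : Fin n → ℕ) → prefix 0 h ≡ 0
prefix-zero {n} h = sum-replicate-zero n

prefix-suc : ∀ {n} c (h : Fin (suc n) → ℕ) → prefix (suc c) h ≡ h zero + prefix c (h ∘ suc)
prefix-suc c h = cong (h zero +_) (sum-cong-≗ λ u → cong (λ b → if b then 0 else h (suc u)) (beyond-suc c u))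

prefix-suc-≤ : ∀ {n} c (h : Fin n → ℕ) B → (∀ u → h u ≤ B) → prefix (suc c) h ≤ B + prefix c h
prefix-suc-≤ {zero}  c       h B h≤B = z≤n
prefix-suc-≤ {suc n} zero    h B h≤B
  rewrite prefix-suc zero h | prefix-zero (h ∘ suc) = +-monoˡ-≤ 0 (h≤B zero)
prefix-suc-≤ {suc n} (suc c) h B h≤B rewrite prefix-suc (suc c) h | prefix-suc c h = begin
  h zero + prefix (suc c) (h ∘ suc)  ≤⟨ +-monoʳ-≤ (h zero) (prefix-suc-≤ c (h ∘ suc) B (h≤B ∘ suc)) ⟩
  h zero + (B + prefix c (h ∘ suc))  ≡⟨ x+[y+z]≡y+[x+z] (h zero) B _ ⟩
  B + (h zero + prefix c (h ∘ suc))  ∎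
  where open ≤-Reasoning

Nonincreasing-tail : ∀ {n} (h : Seq (suc n)) → Nonincreasing h → Nonincreasing (h ∘ suc)
Nonincreasing-tail h h↓ i j i≤j = h↓ (suc i) (suc j) (s≤s i≤j)

prefix-tail-≤ : ∀ {n} c (h : Seq (suc n)) → Nonincreasing h → prefix c (h ∘ suc) ≤ prefix c h
prefix-tail-≤ zero    h h↓ rewrite prefix-zero (h ∘ suc) = z≤n
prefix-tail-≤ (suc c) h h↓ rewrite prefix-suc c h =
  prefix-suc-≤ c (h ∘ suc) (h zero) (λ u → h↓ zero (suc u) z≤n)

∑-in-≤-prefix : ∀ {n} (h : Seq n) → Nonincreasing h → (out : Fin n → Bool) →
  ∑-in out h ≤ prefix (#inside out) h
∑-in-≤-prefix {zero}  h h↓ out = z≤n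
∑-in-≤-prefix {suc n} h h↓ out with out zero
... | true  = ≤-trans (∑-in-≤-prefix (h ∘ suc) (Nonincreasing-tail h h↓) (out ∘ suc))
                      (prefix-tail-≤ (#inside (out ∘ suc)) h h↓)
... | false rewrite prefix-suc (#inside (out ∘ suc)) h =
  +-monoʳ-≤ (h zero) (∑-in-≤-prefix (h ∘ suc) (Nonincreasing-tail h h↓) (out ∘ suc))

prefix-+-≥ : ∀ {n} c t (h : Seq n) B → c + t ≤ n → (∀ u → toℕ u < c + t → B ≤ h u) →
  prefix c h + t * B ≤ prefix (c + t) h
prefix-+-≥ c zero h B _ _ rewrite +-identityʳ c | *-zeroˡ B = ≤-reflexive (+-identityʳ _)
prefix-+-≥ {zero} c (suc t) h B c+t≤n _ with () ← ≤-trans (m≤n+m (suc t) c) c+t≤n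
prefix-+-≥ {suc n} zero (suc t) h B t≤n B≤h
  with prefix-+-≥ zero t (h ∘ suc) B (≤-pred t≤n) (λ u → B≤h (suc u) ∘ s≤s)
... | ih rewrite prefix-zero h | prefix-suc t h =
  +-mono-≤ (B≤h zero (s≤s z≤n)) ih
prefix-+-≥ {suc n} (suc c) (suc t) h B c+t≤n B≤h rewrite prefix-suc c h | prefix-suc (c + suc t) h =
  ≤-trans (≤-reflexive (+-assoc (h zero) (prefix c (h ∘ suc)) (suc t * B)))
    (+-monoʳ-≤ (h zero) (prefix-+-≥ c (suc t) (h ∘ suc) B (≤-pred c+t≤n) (λ u → B≤h (suc u) ∘ s≤s)))

prefix-const : ∀ {n} j → j ≤ n → prefix {n} j (λ _ → 1) ≡ j
prefix-const {n}     zero    _         = prefix-zero {n} (λ _ → 1)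
prefix-const {suc n} (suc j) (s≤s j≤n) = trans (prefix-suc {n} j (λ _ → 1)) (cong suc (prefix-const {n} j j≤n))

prefix-attains : ∀ {n} (I : Fin n → ℕ) → (∀ w → I w ≤ 1) → ∀ j {k} → k ≤ prefix j I →
  Σ[ i ∈ ℕ ] (i ≤ j × prefix i I ≡ k)
prefix-attains I I≤1 zero k≤0 =
  0 , z≤n , trans (prefix-zero I) (sym (n≤0⇒n≡0 (≤-trans k≤0 (≤-reflexive (prefix-zero I)))))
prefix-attains I I≤1 (suc j) {k} k≤ with k ≤? prefix j I
... | yes k≤′ = let i , i≤j , eq = prefix-attains I I≤1 j k≤′ in i , m≤n⇒m≤1+n i≤j , eq
... | no  k≰  = suc j , ≤-refl , ≤-antisym (≤-trans (prefix-suc-≤ j I 1 I≤1) (≰⇒> k≰)) k≤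

-- a + b - c, the shape of Δ_k.  It is opaque so that unification recovers a, b and c.
opaque
  Δ-shape : ℕ → ℕ → ℕ → ℤ.ℤ
  Δ-shape a b c = ℤ.+ a ℤ.+ ℤ.+ b ℤ.- ℤ.+ c

opaque
  unfolding Δ-shape

  Δ-shape-mono : ∀ {a b c a′ b′ c′} → a + b + c′ ≤ a′ + b′ + c → Δ-shape a b c ℤ.≤ Δ-shape a′ b′ c′
  Δ-shape-mono {a} {b} {c} {a′} {b′} {c′} le = begin
    ℤ.+ (a + b) ℤ.- ℤ.+ c          ≡⟨ ℤ.[+m]-[+n]≡m⊖n (a + b) c ⟩
    (a + b) ℤ.⊖ c                  ≡⟨ ℤ.+-cancelˡ-⊖ c′ (a + b) c ⟨
    (c′ + (a + b)) ℤ.⊖ (c′ + c)    ≤⟨ ℤ.⊖-monoˡ-≤ (c′ + c) le′ ⟩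
    (c + (a′ + b′)) ℤ.⊖ (c′ + c)   ≡⟨ cong ((c + (a′ + b′)) ℤ.⊖_) (+-comm c′ c) ⟩
    (c + (a′ + b′)) ℤ.⊖ (c + c′)   ≡⟨ ℤ.+-cancelˡ-⊖ c (a′ + b′) c′ ⟩
    (a′ + b′) ℤ.⊖ c′               ≡⟨ ℤ.[+m]-[+n]≡m⊖n (a′ + b′) c′ ⟨
    ℤ.+ (a′ + b′) ℤ.- ℤ.+ c′       ∎
    where
    open ℤ.≤-Reasoning
    le′ : c′ + (a + b) ≤ c + (a′ + b′)
    le′ = ≤-trans (≤-reflexive (+-comm c′ (a + b))) (≤-trans le (≤-reflexive (+-comm (a′ + b′) c)))

  Δ-unfold : ∀ {n} k (d : Seq n) → Δ k d ≡ Δ-shape (k * (k ∸ 1)) (suffix k (λ u → k ⊓ d u)) (prefix k d)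
  Δ-unfold {n} k d = cong₂ (Δ-shape (k * (k ∸ 1)))
    (sum-allFin n (outside (beyond k) (λ u → k ⊓ d u))) (sum-allFin n (inside (beyond k) d))

Δ-≤-subset : ∀ {n} k (e : Seq n) → Nonincreasing e → (out : Fin n → Bool) → #inside out ≡ k →
  Δ k e ℤ.≤ Δ-shape (k * (k ∸ 1)) (∑-out out (λ u → k ⊓ e u)) (∑-in out e)
Δ-≤-subset k e e↓ out #in≡k = ℤ.≤-trans (ℤ.≤-reflexive (Δ-unfold k e)) (Δ-shape-mono (begin
  k * (k ∸ 1) + suffix k m + ∑-in out e    ≡⟨ +-assoc (k * (k ∸ 1)) _ _ ⟩
  k * (k ∸ 1) + (suffix k m + ∑-in out e)  ≤⟨ +-monoʳ-≤ (k * (k ∸ 1)) exchange ⟩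
  k * (k ∸ 1) + (∑-out out m + prefix k e) ≡⟨ +-assoc (k * (k ∸ 1)) _ _ ⟨
  k * (k ∸ 1) + ∑-out out m + prefix k e   ∎))
  where
  open ≤-Reasoning
  m h : Seq _
  m u = k ⊓ e u
  h u = e u + m u
  h↓ : Nonincreasing h
  h↓ i j i≤j = +-mono-≤ (e↓ i j i≤j) (⊓-monoʳ-≤ k (e↓ i j i≤j))
  shuffle₁ : ∀ x y z w → x + y + (z + w) ≡ (x + w) + (y + z)
  shuffle₁ = solve-∀
  shuffle₂ : ∀ x y z w → x + y + (z + w) ≡ (x + z) + (y + w)
  shuffle₂ = solve-∀
  exchange : suffix k m + ∑-in out e ≤ ∑-out out m + prefix k e
  exchange = +-cancelʳ-≤ (∑-in out m + prefix k m) _ _ (begin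
    suffix k m + ∑-in out e + (∑-in out m + prefix k m)   ≡⟨ shuffle₁ (suffix k m) _ _ (prefix k m) ⟩
    (suffix k m + prefix k m) + (∑-in out e + ∑-in out m)  ≡⟨ cong₂ _+_ (∑-out+∑-in (beyond k) m) (sym (∑-in-+ out e m)) ⟩
    sum m + ∑-in out h                                     ≤⟨ +-monoʳ-≤ (sum m) (∑-in-≤-prefix h h↓ out) ⟩
    sum m + prefix (#inside out) h                         ≡⟨ cong (λ j → sum m + prefix j h) #in≡k ⟩
    sum m + prefix k h                                     ≡⟨ cong₂ _+_ (sym (∑-out+∑-in out m)) (∑-in-+ (beyond k) e m) ⟩
    (∑-out out m + ∑-in out m) + (prefix k e + prefix k m) ≡⟨ shuffle₂ (∑-out out m) _ (prefix k e) _ ⟩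
    (∑-out out m + prefix k e) + (∑-in out m + prefix k m) ∎)

k[k∸1]≤c[c∸1]+2t[k∸1] : ∀ c t k0 → c + t ≡ suc k0 → c ≤ k0 → suc k0 * k0 ≤ c * (c ∸ 1) + t * k0 + t * k0
k[k∸1]≤c[c∸1]+2t[k∸1] zero t k0 refl _ = m≤n+m (suc k0 * k0) (suc k0 * k0)
k[k∸1]≤c[c∸1]+2t[k∸1] (suc c) zero k0 c+0≡k c<k
  rewrite +-identityʳ c with () ← <-irrefl (suc-injective c+0≡k) c<k
k[k∸1]≤c[c∸1]+2t[k∸1] (suc c) (suc t) .(c + suc t) refl _ =
  ≤-trans (m≤m+n _ (t * suc t)) (≤-reflexive (identity c t))
  where
  identity : ∀ c t → suc (c + suc t) * (c + suc t) + t * suc t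
                   ≡ suc c * c + suc t * (c + suc t) + suc t * (c + suc t)
  identity = solve-∀

Δ-≤-small-subset : ∀ {n} k0 (e : Seq n) → Nonincreasing e → suc k0 ≤ n → (∀ u → toℕ u ≤ k0 → k0 ≤ e u) →
  (out : Fin n → Bool) → ∀ c → #inside out ≡ c → c ≤ k0 →
  Δ (suc k0) e ℤ.≤ Δ-shape (c * (c ∸ 1)) (∑-out out e) (∑-in out e)
Δ-≤-small-subset {n} k0 e e↓ k≤n k0≤e out c #in≡c c≤k0 =
  ℤ.≤-trans (ℤ.≤-reflexive (Δ-unfold k e)) (Δ-shape-mono (+-cancelʳ-≤ A _ _ (begin
    k * k0 + suffix k (λ u → k ⊓ e u) + A + A ≤⟨ +-monoˡ-≤ A (+-monoˡ-≤ A (+-mono-≤ pairs-bound clamp-bound)) ⟩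
    cc + tk + tk + S + A + A                  ≡⟨ regroup₁ cc tk S A ⟩
    cc + (S + (A + tk)) + (A + tk)            ≤⟨ +-mono-≤ (+-monoʳ-≤ cc (+-monoʳ-≤ S inside-bound)) inside-bound ⟩
    cc + (S + P) + P                          ≡⟨ cong (λ x → cc + x + P) total ⟩
    cc + (∑-out out e + A) + P                ≡⟨ regroup₂ cc (∑-out out e) A P ⟩
    cc + ∑-out out e + P + A                  ∎)))
  where
  open ≤-Reasoning
  k t cc A S P tk : ℕ
  k = suc k0
  t = k ∸ c
  cc = c * (c ∸ 1)
  A = ∑-in out e
  S = suffix k e
  P = prefix k e
  tk = t * k0
  c+t≡k : c + t ≡ k
  c+t≡k = m+[n∸m]≡n (m≤n⇒m≤1+n c≤k0)
  pairs-bound : k * k0 ≤ cc + tk + tk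
  pairs-bound = k[k∸1]≤c[c∸1]+2t[k∸1] c t k0 c+t≡k c≤k0
  clamp-bound : suffix k (λ u → k ⊓ e u) ≤ S
  clamp-bound = ∑-out-mono (beyond k) (λ u → m⊓n≤n k (e u))
  inside-bound : A + tk ≤ P
  inside-bound = begin
    A + tk                      ≤⟨ +-monoˡ-≤ tk (∑-in-≤-prefix e e↓ out) ⟩
    prefix (#inside out) e + tk ≡⟨ cong (λ x → prefix x e + tk) #in≡c ⟩
    prefix c e + tk             ≤⟨ prefix-+-≥ c t e k0 (subst (_≤ n) (sym c+t≡k) k≤n) leading ⟩
    prefix (c + t) e            ≡⟨ cong (λ x → prefix x e) c+t≡k ⟩
    P                           ∎
    where
    leading : ∀ u → toℕ u < c + t → k0 ≤ e u
    leading u u<c+t = k0≤e u (≤-pred (subst (toℕ u <_) c+t≡k u<c+t))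
  total : S + P ≡ ∑-out out e + A
  total = trans (∑-out+∑-in (beyond k) e) (sym (∑-out+∑-in out e))
  regroup₁ : ∀ cc tk S A → cc + tk + tk + S + A + A ≡ cc + (S + (A + tk)) + (A + tk)
  regroup₁ = solve-∀
  regroup₂ : ∀ cc X A P → cc + (X + A) + P ≡ cc + X + P + A
  regroup₂ = solve-∀

-- m(d) and Δ*(d)

mOf-≥ : ∀ {n} (d : Seq n) i → toℕ i ≤ d i → suc (toℕ i) ≤ mOf d
mOf-≥ d i i≤di = foldr-preservesᵒ step 0 _ (inj₂ (Any.map⁺ (Any.tabulate⁺ i candidate)))
  where
  step : ∀ x y → suc (toℕ i) ≤ x ⊎ suc (toℕ i) ≤ y → suc (toℕ i) ≤ x ⊔ y
  step x y (inj₁ le) = ≤-trans le (m≤m⊔n x y)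
  step x y (inj₂ le) = ≤-trans le (m≤n⊔m x y)
  candidate : suc (toℕ i) ≤ (if toℕ i ≤ᵇ d i then suc (toℕ i) else 0)
  candidate with toℕ i ≤ᵇ d i | ≤⇒≤ᵇ i≤di
  ... | true | _ = ≤-refl

mOf-lub : ∀ {n} (d : Seq n) X → (∀ i → toℕ i ≤ d i → suc (toℕ i) ≤ X) → mOf d ≤ X
mOf-lub d X bound = foldr-preservesᵇ {P = _≤ X} ⊔-lub z≤n (All.map⁺ (All.tabulate⁺ candidate))
  where
  candidate : ∀ i → (if toℕ i ≤ᵇ d i then suc (toℕ i) else 0) ≤ X
  candidate i with toℕ i ≤ᵇ d i in eq
  ... | true  = bound i (≤ᵇ⇒≤ (toℕ i) (d i) (subst T (sym eq) _))
  ... | false = z≤n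

1≤mOf : ∀ {n} (d : Seq (suc n)) → 1 ≤ mOf d
1≤mOf d = mOf-≥ d zero z≤n

mOf≤n : ∀ {n} (d : Seq n) → mOf d ≤ n
mOf≤n d = mOf-lub d _ λ i _ → Fin.toℕ<n i

mOf-beyond : ∀ {n} (d : Seq n) → Nonincreasing d → ∀ w → mOf d ≤ toℕ w → d w < mOf d
mOf-beyond {n} d d↓ w m≤w with mOf d ≤? d w
... | no  m≰dw = ≰⇒> m≰dw
... | yes m≤dw = ⊥-elim (<-irrefl toℕ-i (mOf-≥ d i i≤di))
  where
  m<n : mOf d < n
  m<n = ≤-<-trans m≤w (Fin.toℕ<n w)
  i : Fin n
  i = fromℕ< m<n
  toℕ-i : toℕ i ≡ mOf d
  toℕ-i = Fin.toℕ-fromℕ< m<n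
  i≤di : toℕ i ≤ d i
  i≤di = begin
    toℕ i  ≡⟨ toℕ-i ⟩
    mOf d  ≤⟨ m≤dw ⟩
    d w    ≤⟨ d↓ i w (subst (_≤ toℕ w) (sym toℕ-i) m≤w) ⟩
    d i    ∎
    where open ≤-Reasoning

mOf-leading : ∀ {n} (e : Seq n) → Nonincreasing e → ∀ k0 → suc k0 ≤ mOf e → ∀ u → toℕ u ≤ k0 → k0 ≤ e u
mOf-leading e e↓ k0 k<m u u≤k0 with k0 ≤? e u
... | yes k0≤eu = k0≤eu
... | no  k0≰eu = ⊥-elim (<-irrefl refl (≤-trans k<m (mOf-lub e k0 bound)))
  where
  bound : ∀ i → toℕ i ≤ e i → suc (toℕ i) ≤ k0
  bound i i≤ei with toℕ u ≤? toℕ i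
  ... | yes u≤i = ≤-<-trans i≤ei (≤-<-trans (e↓ u i u≤i) (≰⇒> k0≰eu))
  ... | no  u≰i = ≤-trans (≰⇒> u≰i) u≤k0

Δ*-≥ : ∀ {n} (d : Seq (suc n)) k → 1 ≤ k → k ≤ mOf d → Δ k d ℤ.≤ Δ* d
Δ*-≥ d (suc j) _ j<m = foldr-preservesᵒ step (Δ 1 d) _ (inj₂ (Any.map⁺ (Any.applyUpTo⁺ (λ i → i) ℤ.≤-refl j<m)))
  where
  step : ∀ x y → Δ (suc j) d ℤ.≤ x ⊎ Δ (suc j) d ℤ.≤ y → Δ (suc j) d ℤ.≤ x ℤ.⊔ y
  step x y (inj₁ le) = ℤ.≤-trans le (ℤ.i≤i⊔j x y)
  step x y (inj₂ le) = ℤ.≤-trans le (ℤ.i≤j⊔i x y)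

Δ*-lub : ∀ {n} (d : Seq (suc n)) X → (∀ k0 → suc k0 ≤ mOf d → Δ (suc k0) d ℤ.≤ X) → Δ* d ℤ.≤ X
Δ*-lub d X bound = foldr-preservesᵇ {P = ℤ._≤ X} ℤ.⊔-lub (bound 0 (1≤mOf d))
  (All.map⁺ (All.applyUpTo⁺₁ (λ i → i) (mOf d) (λ {k0} → bound k0)))

-- Counting adjacent pairs

m*[m∸1]+m≡m*m : ∀ m → m * (m ∸ 1) + m ≡ m * m
m*[m∸1]+m≡m*m zero    = refl
m*[m∸1]+m≡m*m (suc m) = lemma m
  where
  lemma : ∀ m → suc m * m + suc m ≡ suc m * suc m
  lemma = solve-∀

module Counting {N} (G : SimpleGraph N) where

  edge : Fin N → Fin N → ℕ
  edge v w = if adj G v w then 1 else 0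

  edge-sym : ∀ v w → edge v w ≡ edge w v
  edge-sym v w = cong (λ b → if b then 1 else 0) (SimpleGraph.sym G v w)

  edge+δ≤1 : ∀ v w → edge v w + δ v w ≤ 1
  edge+δ≤1 v w with v Fin.≟ w
  ... | yes refl rewrite irrefl G v = ≤-refl
  ... | no _ with adj G v w
  ...   | true  = ≤-refl
  ...   | false = z≤n

  edge≤1 : ∀ v w → edge v w ≤ 1
  edge≤1 v w = ≤-trans (m≤m+n (edge v w) (δ v w)) (edge+δ≤1 v w)

  deg : (Fin N → ℕ) → Fin N → ℕ
  deg s v = ∑[ w < N ] (s w * edge v w)

  deg₁ : Fin N → ℕ
  deg₁ = deg (λ _ → 1)

  pairs : (Fin N → ℕ) → (Fin N → ℕ) → ℕ
  pairs s t = ∑[ v < N ] (s v * deg t v)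

  degree≡deg : ∀ v → degree G v ≡ deg₁ v
  degree≡deg v = trans (sum-allFin N (edge v)) (sum-cong-≗ λ w → sym (*-identityˡ (edge v w)))

  deg-cong : ∀ {s t} → (∀ w → s w ≡ t w) → ∀ v → deg s v ≡ deg t v
  deg-cong s≡t v = sum-cong-≗ λ w → cong (_* edge v w) (s≡t w)

  deg-+ : ∀ s t v → deg (λ w → s w + t w) v ≡ deg s v + deg t v
  deg-+ s t v = trans (sum-cong-≗ λ w → *-distribʳ-+ (edge v w) (s w) (t w))
                      (∑-distrib-+ (λ w → s w * edge v w) (λ w → t w * edge v w))

  deg-mono : ∀ {s t} → (∀ w → s w ≤ t w) → ∀ v → deg s v ≤ deg t v
  deg-mono s≤t v = ∑-mono-≤ λ w → *-monoˡ-≤ (edge v w) (s≤t w)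

  deg≤sum : ∀ s v → deg s v ≤ sum s
  deg≤sum s v = ∑-mono-≤ λ w → ≤-trans (*-monoʳ-≤ (s w) (edge≤1 v w)) (≤-reflexive (*-identityʳ (s w)))

  deg+self≤sum : ∀ s v → deg s v + s v ≤ sum s
  deg+self≤sum s v = begin
    deg s v + s v                                      ≡⟨ cong (deg s v +_) (∑-δ v s) ⟨
    deg s v + ∑[ w < N ] (δ v w * s w)                 ≡⟨ ∑-distrib-+ (λ w → s w * edge v w) (λ w → δ v w * s w) ⟨
    ∑[ w < N ] (s w * edge v w + δ v w * s w)          ≤⟨ ∑-mono-≤ at-most-once ⟩
    sum s                                              ∎
    where
    open ≤-Reasoning
    at-most-once : ∀ w → s w * edge v w + δ v w * s w ≤ s w
    at-most-once w = begin
      s w * edge v w + δ v w * s w  ≡⟨ cong (s w * edge v w +_) (*-comm (δ v w) (s w)) ⟩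
      s w * edge v w + s w * δ v w  ≡⟨ *-distribˡ-+ (s w) (edge v w) (δ v w) ⟨
      s w * (edge v w + δ v w)      ≤⟨ *-monoʳ-≤ (s w) (edge+δ≤1 v w) ⟩
      s w * 1                       ≡⟨ *-identityʳ (s w) ⟩
      s w                           ∎

  pairs-cong : ∀ {s s′ t t′} → (∀ v → s v ≡ s′ v) → (∀ v → t v ≡ t′ v) → pairs s t ≡ pairs s′ t′
  pairs-cong s≡s′ t≡t′ = sum-cong-≗ λ v → cong₂ _*_ (s≡s′ v) (deg-cong t≡t′ v)

  pairs-comm : ∀ s t → pairs s t ≡ pairs t s
  pairs-comm s t = begin
    ∑[ v < N ] (s v * deg t v)                       ≡⟨ sum-cong-≗ (λ v → *-distribˡ-sum (s v) (λ w → t w * edge v w)) ⟩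
    ∑[ v < N ] ∑[ w < N ] (s v * (t w * edge v w))   ≡⟨ ∑-comm (λ v w → s v * (t w * edge v w)) ⟩
    ∑[ w < N ] ∑[ v < N ] (s v * (t w * edge v w))   ≡⟨ sum-cong-≗ (λ w → sum-cong-≗ (swap w)) ⟩
    ∑[ w < N ] ∑[ v < N ] (t w * (s v * edge w v))   ≡⟨ sum-cong-≗ (λ w → *-distribˡ-sum (t w) (λ v → s v * edge w v)) ⟨
    ∑[ w < N ] (t w * deg s w)                       ∎
    where
    open ≡-Reasoning
    swap : ∀ w v → s v * (t w * edge v w) ≡ t w * (s v * edge w v)
    swap w v = trans (x*[y*z]≡y*[x*z] (s v) (t w) (edge v w)) (cong (λ a → t w * (s v * a)) (edge-sym v w))

  pairs-+ʳ : ∀ s t u → pairs s (λ w → t w + u w) ≡ pairs s t + pairs s u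
  pairs-+ʳ s t u = trans
    (sum-cong-≗ λ v → trans (cong (s v *_) (deg-+ t u v)) (*-distribˡ-+ (s v) (deg t v) (deg u v)))
    (∑-distrib-+ (λ v → s v * deg t v) (λ v → s v * deg u v))

  pairs-+ˡ : ∀ s t u → pairs (λ v → s v + t v) u ≡ pairs s u + pairs t u
  pairs-+ˡ s t u = begin
    pairs (λ v → s v + t v) u    ≡⟨ pairs-comm (λ v → s v + t v) u ⟩
    pairs u (λ v → s v + t v)    ≡⟨ pairs-+ʳ u s t ⟩
    pairs u s + pairs u t        ≡⟨ cong₂ _+_ (pairs-comm u s) (pairs-comm u t) ⟩
    pairs s u + pairs t u        ∎
    where open ≡-Reasoning

  pairs≤sum*sum : ∀ s t → pairs s t ≤ sum s * sum t
  pairs≤sum*sum s t = begin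
    pairs s t                   ≤⟨ ∑-mono-≤ (λ v → *-monoʳ-≤ (s v) (deg≤sum t v)) ⟩
    ∑[ v < N ] (s v * sum t)    ≡⟨ *-distribʳ-sum (sum t) s ⟨
    sum s * sum t               ∎
    where open ≤-Reasoning

  pairs-self : ∀ s → (∀ v → s v ≤ 1) → pairs s s + sum s ≤ sum s * sum s
  pairs-self s s≤1 = begin
    pairs s s + sum s                    ≡⟨ ∑-distrib-+ (λ v → s v * deg s v) s ⟨
    ∑[ v < N ] (s v * deg s v + s v)     ≤⟨ ∑-mono-≤ pointwise ⟩
    ∑[ v < N ] (s v * sum s)             ≡⟨ *-distribʳ-sum (sum s) s ⟨
    sum s * sum s                        ∎
    where
    open ≤-Reasoning
    pointwise : ∀ v → s v * deg s v + s v ≤ s v * sum s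
    pointwise v with s v | s≤1 v | deg+self≤sum s v
    ... | zero  | _ | _     = z≤n
    ... | suc zero | _ | le = ≤-trans (≤-reflexive (cong (_+ 1) (+-identityʳ (deg s v))))
                                      (≤-trans le (≤-reflexive (sym (+-identityʳ (sum s)))))
    ... | suc (suc _) | s≤s () | _

  pairs-≤-enlarge : ∀ P S R → (∀ v → P v ≡ S v + R v) → (∀ v → S v ≤ 1) → (∀ v → R v ≤ 1) →
    pairs P P + sum S * (sum S ∸ 1) ≤ pairs S S + sum P * (sum P ∸ 1)
  pairs-≤-enlarge P S R P≡S+R S≤1 R≤1 = +-cancelʳ-≤ (c + K) _ _ (begin
    pairs P P + cc + (c + K)                     ≡⟨ cong₂ (λ x y → x + cc + (c + y)) expand K≡c+r ⟩
    pSS + pSR + (pRS + pRR) + cc + (c + (c + r)) ≡⟨ regroup₁ pSS pSR pRS pRR cc c r ⟩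
    pSS + pSR + pRS + (pRR + r) + (cc + c) + c   ≡⟨ cong₂ (λ x y → pSS + pSR + x + (pRR + r) + y + c)
                                                           (pairs-comm R S) (m*[m∸1]+m≡m*m c) ⟩
    pSS + pSR + pSR + (pRR + r) + c * c + c      ≤⟨ +-monoˡ-≤ c (+-monoˡ-≤ (c * c) (+-mono-≤
                                                      (+-mono-≤ (+-monoʳ-≤ pSS cross) cross) (pairs-self R R≤1))) ⟩
    pSS + c * r + c * r + r * r + c * c + c      ≡⟨ regroup₂ pSS c r ⟩
    pSS + (c + r) * (c + r) + c                  ≡⟨ cong (λ x → pSS + x * x + c) K≡c+r ⟨
    pSS + K * K + c                              ≡⟨ cong (λ x → pSS + x + c) (m*[m∸1]+m≡m*m K) ⟨
    pSS + (KK + K) + c                           ≡⟨ regroup₃ pSS KK K c ⟩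
    pSS + KK + (c + K)                           ∎)
    where
    open ≤-Reasoning
    c r K cc KK pSS pSR pRS pRR : ℕ
    c = sum S
    r = sum R
    K = sum P
    cc = c * (c ∸ 1)
    KK = K * (K ∸ 1)
    pSS = pairs S S
    pSR = pairs S R
    pRS = pairs R S
    pRR = pairs R R
    K≡c+r : K ≡ c + r
    K≡c+r = trans (sum-cong-≗ P≡S+R) (∑-distrib-+ S R)
    expand : pairs P P ≡ pSS + pSR + (pRS + pRR)
    expand = begin-equality
      pairs P P                                            ≡⟨ pairs-cong P≡S+R P≡S+R ⟩
      pairs (λ v → S v + R v) (λ v → S v + R v)             ≡⟨ pairs-+ˡ S R (λ v → S v + R v) ⟩
      pairs S (λ v → S v + R v) + pairs R (λ v → S v + R v) ≡⟨ cong₂ _+_ (pairs-+ʳ S S R) (pairs-+ʳ R S R) ⟩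
      pSS + pSR + (pRS + pRR)                              ∎
    cross : pSR ≤ c * r
    cross = pairs≤sum*sum S R
    regroup₁ : ∀ a b b′ d x c r → a + b + (b′ + d) + x + (c + (c + r)) ≡ a + b + b′ + (d + r) + (x + c) + c
    regroup₁ = solve-∀
    regroup₂ : ∀ a c r → a + c * r + c * r + r * r + c * c + c ≡ a + (c + r) * (c + r) + c
    regroup₂ = solve-∀
    regroup₃ : ∀ a x K c → a + (x + K) + c ≡ a + x + (c + K)
    regroup₃ = solve-∀

  ∑-in≡pairs : ∀ out X → ∑-in out (λ v → X v * deg X v)
             ≡ pairs (inside out X) (inside out X) + ∑-out out (λ v → X v * deg (inside out X) v)
  ∑-in≡pairs out X = begin
    ∑-in out (λ v → X v * deg X v)           ≡⟨ sum-cong-≗ (λ v → restrict-* v (out v)) ⟩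
    pairs Xin X                              ≡⟨ pairs-cong {Xin} (λ _ → refl) split ⟩
    pairs Xin (λ w → Xin w + Xout w)         ≡⟨ pairs-+ʳ Xin Xin Xout ⟩
    pairs Xin Xin + pairs Xin Xout           ≡⟨ cong (pairs Xin Xin +_) (pairs-comm Xin Xout) ⟩
    pairs Xin Xin + pairs Xout Xin           ≡⟨ cong (pairs Xin Xin +_) (sum-cong-≗ λ v → restrict-*′ v (out v)) ⟨
    pairs Xin Xin + ∑-out out (λ v → X v * deg Xin v) ∎
    where
    open ≡-Reasoning
    Xin Xout : Fin N → ℕ
    Xin = inside out X
    Xout = outside out X
    restrict-* : ∀ {y} v b → (if b then 0 else X v * y) ≡ (if b then 0 else X v) * y
    restrict-* v true  = refl
    restrict-* v false = refl
    restrict-*′ : ∀ {y} v b → (if b then X v * y else 0) ≡ (if b then X v else 0) * y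
    restrict-*′ v true  = refl
    restrict-*′ v false = refl
    split : ∀ w → X w ≡ Xin w + Xout w
    split w with out w
    ... | true  = refl
    ... | false = sym (+-identityʳ (X w))

  module Cut (out : Fin N → Bool) (I : Fin N → ℕ) (I≤1 : ∀ w → I w ≤ 1) where

    P S R : Fin N → ℕ
    P = inside out (λ _ → 1)
    S = inside out I
    R = inside out (λ w → 1 ∸ I w)

    P≡S+R : ∀ w → P w ≡ S w + R w
    P≡S+R w with out w
    ... | true  = refl
    ... | false = sym (m+[n∸m]≡n (I≤1 w))

    S≤1 : ∀ w → S w ≤ 1
    S≤1 w with out w
    ... | true  = z≤n
    ... | false = I≤1 w

    R≤1 : ∀ w → R w ≤ 1
    R≤1 w with out w
    ... | true  = z≤n
    ... | false = m∸n≤m 1 (I w)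

    -- Adjacent pairs inside P are handled by pairs-≤-enlarge, those at an outside
    -- vertex x are bounded by β x.
    cut-≤ : ∀ (α β : Fin N → ℕ) → (∀ x → deg P x ≤ β x) → (∀ x → α x + deg R x ≤ β x) →
      ∑-in out I * (∑-in out I ∸ 1) + ∑-out out (λ x → I x * α x) + ∑-in out deg₁
        ≤ #inside out * (#inside out ∸ 1) + ∑-out out β + ∑-in out (λ x → I x * deg I x)
    cut-≤ α β unmarked marked = begin
      cc + A + ∑-in out deg₁   ≡⟨ cong (cc + A +_) ∑-in-deg ⟩
      cc + A + (pairs P P + B)             ≡⟨ regroup₁ cc A (pairs P P) B ⟩
      (pairs P P + cc) + (A + B)           ≤⟨ +-mono-≤ (pairs-≤-enlarge P S R P≡S+R S≤1 R≤1) outside-≤ ⟩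
      (pairs S S + KK) + (∑-out out β + C) ≡⟨ regroup₂ (pairs S S) KK (∑-out out β) C ⟩
      KK + ∑-out out β + (pairs S S + C)   ≡⟨ cong (KK + ∑-out out β +_) (∑-in≡pairs out I) ⟨
      KK + ∑-out out β + ∑-in out (λ x → I x * deg I x) ∎
      where
      open ≤-Reasoning
      regroup₁ : ∀ c a p b → c + a + (p + b) ≡ (p + c) + (a + b)
      regroup₁ = solve-∀
      regroup₂ : ∀ s k b c → (s + k) + (b + c) ≡ k + b + (s + c)
      regroup₂ = solve-∀
      regroup₃ : ∀ a s r → a + 0 + (s + r) ≡ s + (a + r)
      regroup₃ = solve-∀
      regroup₄ : ∀ s b → s + b ≡ b + (s + 0)
      regroup₄ = solve-∀
      cc KK A B C : ℕ
      cc = ∑-in out I * (∑-in out I ∸ 1)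
      KK = #inside out * (#inside out ∸ 1)
      A = ∑-out out (λ x → I x * α x)
      B = ∑-out out (deg P)
      C = ∑-out out (λ x → I x * deg S x)
      ∑-in-deg : ∑-in out deg₁ ≡ pairs P P + B
      ∑-in-deg = trans (∑-in-cong out (λ v → sym (*-identityˡ (deg₁ v))))
        (trans (∑-in≡pairs out (λ _ → 1)) (cong (pairs P P +_) (∑-out-cong out (λ v → *-identityˡ (deg P v)))))
      pointwise : ∀ x → I x * α x + deg P x ≤ β x + I x * deg S x
      pointwise x with I x | I≤1 x
      ... | zero     | _ = ≤-trans (unmarked x) (m≤m+n (β x) 0)
      ... | suc zero | _ = begin
        α x + 0 + deg P x          ≡⟨ cong (α x + 0 +_) (trans (deg-cong P≡S+R x) (deg-+ S R x)) ⟩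
        α x + 0 + (deg S x + deg R x) ≡⟨ regroup₃ (α x) (deg S x) (deg R x) ⟩
        deg S x + (α x + deg R x)  ≤⟨ +-monoʳ-≤ (deg S x) (marked x) ⟩
        deg S x + β x              ≡⟨ regroup₄ (deg S x) (β x) ⟩
        β x + (deg S x + 0)        ∎
      ... | suc (suc _) | s≤s ()
      outside-≤ : A + B ≤ ∑-out out β + C
      outside-≤ = begin
        A + B                                                ≡⟨ ∑-out-+ out (λ x → I x * α x) (deg P) ⟨
        ∑-out out (λ x → I x * α x + deg P x)                ≤⟨ ∑-out-mono out pointwise ⟩
        ∑-out out (λ x → β x + I x * deg S x)                ≡⟨ ∑-out-+ out β (λ x → I x * deg S x) ⟩
        ∑-out out β + C                                      ∎

    private
      c K : ℕ
      c = ∑-in out I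
      K = #inside out

    deg-P≤deg : ∀ x → deg P x ≤ deg₁ x
    deg-P≤deg = deg-mono P≤1
      where
      P≤1 : ∀ w → P w ≤ 1
      P≤1 w with out w
      ... | true  = z≤n
      ... | false = ≤-refl

    deg-R+c≤K : ∀ x → deg R x + c ≤ K
    deg-R+c≤K x = begin
      deg R x + sum S  ≤⟨ +-monoˡ-≤ (sum S) (deg≤sum R x) ⟩
      sum R + sum S    ≡⟨ +-comm (sum R) (sum S) ⟩
      sum S + sum R    ≡⟨ ∑-distrib-+ S R ⟨
      ∑[ w < N ] (S w + R w) ≡⟨ sum-cong-≗ P≡S+R ⟨
      K                ∎
      where open ≤-Reasoning

    deg-R+deg-I≤deg : ∀ x → deg R x + deg I x ≤ deg₁ x
    deg-R+deg-I≤deg x = ≤-trans (≤-reflexive (sym (deg-+ R I x))) (deg-mono R+I≤1 x)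
      where
      R+I≤1 : ∀ w → R w + I w ≤ 1
      R+I≤1 w with out w
      ... | true  = I≤1 w
      ... | false = ≤-reflexive (m∸n+n≡m (I≤1 w))

    Δ-shape-cut-clamped :
      Δ-shape (c * (c ∸ 1)) (∑-out out (λ x → I x * (c ⊓ deg I x))) (∑-in out (λ x → I x * deg I x))
        ℤ.≤ Δ-shape (K * (K ∸ 1)) (∑-out out (λ x → K ⊓ deg₁ x)) (∑-in out deg₁)
    Δ-shape-cut-clamped =
      Δ-shape-mono (cut-≤ (λ x → c ⊓ deg I x) (λ x → K ⊓ deg₁ x) unmarked marked)
      where
      unmarked : ∀ x → deg P x ≤ K ⊓ deg₁ x
      unmarked x = ⊓-glb (deg≤sum P x) (deg-P≤deg x)
      marked : ∀ x → c ⊓ deg I x + deg R x ≤ K ⊓ deg₁ x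
      marked x = begin
        c ⊓ deg I x + deg R x              ≡⟨ +-comm (c ⊓ deg I x) (deg R x) ⟩
        deg R x + c ⊓ deg I x              ≡⟨ +-distribˡ-⊓ (deg R x) c (deg I x) ⟩
        (deg R x + c) ⊓ (deg R x + deg I x) ≤⟨ ⊓-mono-≤ (deg-R+c≤K x) (deg-R+deg-I≤deg x) ⟩
        K ⊓ deg₁ x                ∎
        where open ≤-Reasoning

    Δ-shape-cut :
      Δ-shape (c * (c ∸ 1)) (∑-out out (λ x → I x * deg I x)) (∑-in out (λ x → I x * deg I x))
        ℤ.≤ Δ-shape (K * (K ∸ 1)) (∑-out out deg₁) (∑-in out deg₁)
    Δ-shape-cut = Δ-shape-mono (cut-≤ (deg I) deg₁ deg-P≤deg marked)
      where
      marked : ∀ x → deg I x + deg R x ≤ deg₁ x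
      marked x = ≤-trans (≤-reflexive (+-comm (deg I x) (deg R x))) (deg-R+deg-I≤deg x)

-- Induced subgraphs

module _ {M n} {e : Seq M} {d : Seq (suc n)} (e↓ : Nonincreasing e) (d↓ : Nonincreasing d)
         (H : SimpleGraph M) (G : SimpleGraph (suc n)) (H-e : HasDegSeq H e) (G-d : HasDegSeq G d)
         (f : Fin M → Fin (suc n)) (f-inj : Injective _≡_ _≡_ f)
         (f-induced : ∀ u v → adj H u v ≡ adj G (f u) (f v)) where

  open Counting G

  private
    I : Fin (suc n) → ℕ
    I = multiplicity f

  e≡deg : ∀ u → e u ≡ deg I (f u)
  e≡deg u = begin
    e u                                            ≡⟨ H-e u ⟨
    degree H u                                     ≡⟨ sum-allFin M (λ v → if adj H u v then 1 else 0) ⟩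
    ∑[ v < M ] (if adj H u v then 1 else 0)        ≡⟨ sum-cong-≗ (λ v → cong (λ b → if b then 1 else 0) (f-induced u v)) ⟩
    ∑[ v < M ] edge (f u) (f v)                    ≡⟨ ∑-∘ f (edge (f u)) ⟩
    deg I (f u)                                    ∎
    where open ≡-Reasoning

  d≡deg : ∀ w → d w ≡ deg₁ w
  d≡deg w = trans (sym (G-d w)) (degree≡deg w)

  #inside-∘ : ∀ out → #inside (out ∘ f) ≡ ∑-in out I
  #inside-∘ out = trans (∑-in-∘ f out (λ _ → 1)) (∑-in-cong out (λ w → *-identityʳ (I w)))

  Δ≡Δ-shape-deg : ∀ j → j ≤ suc n → let K = #inside {suc n} (beyond j) in
    Δ j d ≡ Δ-shape (K * (K ∸ 1)) (∑-out (beyond j) (λ w → K ⊓ deg₁ w)) (∑-in (beyond j) deg₁)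
  Δ≡Δ-shape-deg j j≤N = begin
    Δ j d
      ≡⟨ Δ-unfold j d ⟩
    Δ-shape (j * (j ∸ 1)) (suffix j (λ w → j ⊓ d w)) (prefix j d)
      ≡⟨ cong₂ (Δ-shape (j * (j ∸ 1))) (∑-out-cong (beyond j) (λ w → cong (j ⊓_) (d≡deg w)))
                                       (∑-in-cong (beyond j) d≡deg) ⟩
    Δ-shape (j * (j ∸ 1)) (∑-out (beyond j) (λ w → j ⊓ deg₁ w)) (∑-in (beyond j) deg₁)
      ≡⟨ cong (λ x → Δ-shape (x * (x ∸ 1)) (∑-out (beyond j) (λ w → x ⊓ deg₁ w)) (∑-in (beyond j) deg₁))
              (prefix-const j j≤N) ⟨
    Δ-shape (K * (K ∸ 1)) (∑-out (beyond j) (λ w → K ⊓ deg₁ w)) (∑-in (beyond j) deg₁)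
      ∎
    where
    open ≡-Reasoning
    K : ℕ
    K = #inside {suc n} (beyond j)

  Δ-prefix-≤-Δ : ∀ j → j ≤ suc n → Δ (prefix j I) e ℤ.≤ Δ j d
  Δ-prefix-≤-Δ j j≤N = begin
    Δ c e
      ≤⟨ Δ-≤-subset c e e↓ (out ∘ f) (#inside-∘ out) ⟩
    Δ-shape (c * (c ∸ 1)) (∑-out (out ∘ f) (λ u → c ⊓ e u)) (∑-in (out ∘ f) e)
      ≡⟨ cong₂ (Δ-shape (c * (c ∸ 1))) outside-≡ inside-≡ ⟩
    Δ-shape (c * (c ∸ 1)) (∑-out out (λ w → I w * (c ⊓ deg I w))) (∑-in out (λ w → I w * deg I w))
      ≤⟨ Δ-shape-cut-clamped ⟩
    Δ-shape (K * (K ∸ 1)) (∑-out out (λ w → K ⊓ deg₁ w)) (∑-in out deg₁)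
      ≡⟨ Δ≡Δ-shape-deg j j≤N ⟨
    Δ j d ∎
    where
    open ℤ.≤-Reasoning
    out : Fin (suc n) → Bool
    out = beyond j
    open Cut out I (multiplicity≤1 f f-inj)
    c K : ℕ
    c = prefix j I
    K = #inside out
    inside-≡ : ∑-in (out ∘ f) e ≡ ∑-in out (λ w → I w * deg I w)
    inside-≡ = trans (∑-in-cong (out ∘ f) e≡deg) (∑-in-∘ f out (deg I))
    outside-≡ : ∑-out (out ∘ f) (λ u → c ⊓ e u) ≡ ∑-out out (λ w → I w * (c ⊓ deg I w))
    outside-≡ = trans (∑-out-cong (out ∘ f) (λ u → cong (c ⊓_) (e≡deg u))) (∑-out-∘ f out (λ w → c ⊓ deg I w))

  Δ-≤-Δ-unclamped : ∀ j → j ≤ suc n → (∀ w → j ≤ toℕ w → d w ≤ j) →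
    ∀ k0 → suc k0 ≤ mOf e → prefix j I ≤ k0 → Δ (suc k0) e ℤ.≤ Δ j d
  Δ-≤-Δ-unclamped j j≤N d≤j k0 k≤m c≤k0 = begin
    Δ (suc k0) e
      ≤⟨ Δ-≤-small-subset k0 e e↓ (≤-trans k≤m (mOf≤n e)) (mOf-leading e e↓ k0 k≤m) (out ∘ f) c (#inside-∘ out) c≤k0 ⟩
    Δ-shape (c * (c ∸ 1)) (∑-out (out ∘ f) e) (∑-in (out ∘ f) e)
      ≡⟨ cong₂ (Δ-shape (c * (c ∸ 1))) outside-≡ inside-≡ ⟩
    Δ-shape (c * (c ∸ 1)) (∑-out out (λ w → I w * deg I w)) (∑-in out (λ w → I w * deg I w))
      ≤⟨ Δ-shape-cut ⟩
    Δ-shape (K * (K ∸ 1)) (∑-out out deg₁) (∑-in out deg₁)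
      ≡⟨ cong (λ x → Δ-shape (K * (K ∸ 1)) x (∑-in out deg₁)) (sum-cong-≗ unclamp) ⟩
    Δ-shape (K * (K ∸ 1)) (∑-out out (λ w → K ⊓ deg₁ w)) (∑-in out deg₁)
      ≡⟨ Δ≡Δ-shape-deg j j≤N ⟨
    Δ j d ∎
    where
    open ℤ.≤-Reasoning
    out : Fin (suc n) → Bool
    out = beyond j
    open Cut out I (multiplicity≤1 f f-inj)
    c K : ℕ
    c = prefix j I
    K = #inside out
    inside-≡ : ∑-in (out ∘ f) e ≡ ∑-in out (λ w → I w * deg I w)
    inside-≡ = trans (∑-in-cong (out ∘ f) e≡deg) (∑-in-∘ f out (deg I))
    outside-≡ : ∑-out (out ∘ f) e ≡ ∑-out out (λ w → I w * deg I w)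
    outside-≡ = trans (∑-out-cong (out ∘ f) e≡deg) (∑-out-∘ f out (deg I))
    unclamp : ∀ w → outside out deg₁ w ≡ outside out (λ w → K ⊓ deg₁ w) w
    unclamp w with beyond j w in beyond-w
    ... | true  = sym (m≥n⇒m⊓n≡n deg≤K)
      where
      deg≤K : deg₁ w ≤ K
      deg≤K = subst₂ _≤_ (d≡deg w) (sym (prefix-const j j≤N)) (d≤j w (≤ᵇ⇒≤ j (toℕ w) (subst T (sym beyond-w) _)))
    ... | false = refl

  -- The first j vertices of G contain prefix j I vertices of H, a count that rises by
  -- at most one per step: either it reaches k at some j ≤ m(d), or it stays below k
  -- up to m(d), beyond which no degree exceeds m(d).
  Δ-≤-Δ* : ∀ k0 → suc k0 ≤ mOf e → Δ (suc k0) e ℤ.≤ Δ* d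
  Δ-≤-Δ* k0 k≤m with suc k0 ≤? prefix (mOf d) I
  ... | no k≰c = ℤ.≤-trans
    (Δ-≤-Δ-unclamped (mOf d) (mOf≤n d) (λ w m≤w → <⇒≤ (mOf-beyond d d↓ w m≤w)) k0 k≤m (≤-pred (≰⇒> k≰c)))
    (Δ*-≥ d (mOf d) (1≤mOf d) ≤-refl)
  ... | yes k≤c with prefix-attains I (multiplicity≤1 f f-inj) (mOf d) k≤c
  ...   | zero  , _   , c≡k = ⊥-elim (0≢1+n (trans (sym (prefix-zero I)) c≡k))
  ...   | suc j , j<m , c≡k =
    ℤ.≤-trans (subst (λ x → Δ x e ℤ.≤ Δ (suc j) d) c≡k (Δ-prefix-≤-Δ (suc j) (≤-trans j<m (mOf≤n d))))
              (Δ*-≥ d (suc j) (s≤s z≤n) j<m)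

theorem4p2 : ∀ {m n} (e : Seq (suc m)) (d : Seq (suc n)) →
    IsDegSeq e → IsDegSeq d → e ≼ d → Δ* e ℤ.≤ Δ* d
theorem4p2 e d (e↓ , _) (d↓ , _) (H , G , H-e , G-d , f , f-inj , f-induced) =
  Δ*-lub e (Δ* d) (Δ-≤-Δ* e↓ d↓ H G H-e G-d f f-inj f-induced)
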